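{- Let $n\ge 2$ and let $\pi\in M_{2n}$ have a difference sequence that is periodic with period $p$. Then the number of valid pointer contexts (of the permutation in $S_{2n}$ whose contraction is $\pi$) is a multiple of $\frac{2n-1}{p}$.
   Context: Permutations are bijections of $\mathbb Z_N$ written $[\pi(1)\ \cdots\ \pi(N)]$; indices and entries are taken modulo $N$. For $\pi\in S_N$ the difference sequence $D_\pi$ is $D_\pi(k)=\pi(k+1)-\pi(k)$ for $1\le k<N$ and $D_\pi(N)=\pi(1)-\pi(N)$; it is periodic with period $p$ if $p$ is the smallest integer with $0<p<N$ such that $D_\pi(k+p)=D_\pi(k)$ for all $k$. Pointers: entry $k$ has left pointer $(k-1,k)$ and right pointer $(k,k+1)$; the pointer word $W(\pi)$ lists $L(\pi(1))R(\pi(1))\cdots L(\pi(N))R(\pi(N))$ with $(0,1)$ and $(N,N+1)$ removed. Two distinct pointers form a valid pointer context if their occurrences in $W(\pi)$ interleave ($p\ldots q\ldots p\ldots q$ or $q\ldots p\ldots q\ldots p$). Strategic pile: with $X_N=(0\ 1\ \cdots\ N)$, $Y_\pi=(\pi(N)\ \cdots\ \pi(1)\ 0)$ and $C_\pi=Y_\pi\circ X_N$, $\mathrm{SP}(\pi)$ is the set of numbers after $N$ and before $0$ in the cycle of $C_\pi$ containing $0$ and $N$ (empty if different cycles). $\pi\in S_{2n}$ has maximal strategic pile if $|\mathrm{SP}(\pi)|=2n-1$; then $2n$ is immediately followed by $1$, and its contraction is the element of $S_{2n-1}$ obtained by deleting the entry $2n$, with the pointer $(2n-1,2n)$ renamed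 $(2n-1,1)$. $M_{2n}$ is the set of all such contractions. -}

module Defs where

open import Data.Nat using (ℕ; zero; suc; _+_; _∸_; _<ᵇ_; _%_; _≤_; _<_)
open import Data.Nat.Properties using (_≟_)
open import Data.Bool using (Bool; true; false; if_then_else_)
open import Data.Product using (_×_; _,_)
open import Data.Product.Properties using (≡-dec)
open import Data.Sum using (_⊎_)
open import Data.List using (List; []; _∷_; map; upTo; _++_; length; filter; concatMap)
open import Data.List.Properties as LP using ()
open import Data.Maybe using (Maybe; just; nothing) renaming (map to mapMaybe)
open import Relation.Nullary using (Dec; yes; no; ¬_)
open import Relation.Nullary.Decidable using (_⊎-dec_; ¬?)
open import Relation.Binary.PropositionalEquality using (_≡_)

-- Permutations of {1,…,N} are represented in one-line notation as a
-- list  [π(1) … π(N)]  of natural numbers.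

range1 : ℕ → List ℕ
range1 N = map suc (upTo N)

nth : List ℕ → ℕ → ℕ
nth []       _       = 0
nth (x ∷ xs) zero    = x
nth (x ∷ xs) (suc i) = nth xs i

-- 1-indexed position of x in the list (0 if absent)
pos : List ℕ → ℕ → ℕ
pos []       x = 0
pos (y ∷ ys) x with x ≟ y
... | yes _ = 1
... | no  _ with pos ys x
...   | zero  = 0
...   | suc j = suc (suc j)

-- reduction modulo N (total: modulo 0 is the identity)
modN : ℕ → ℕ → ℕ
modN x zero    = x
modN x (suc m) = x % suc m

-- π(k) for k ≥ 1, index read modulo N
entry : ℕ → List ℕ → ℕ → ℕ
entry N π k = nth π (modN (k ∸ 1) N)

-- D_π(k) = π(k+1) - π(k)  in ℤ_N, for k ≥ 1 (cyclically, so D_π(N) = π(1) - π(N))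
diffSeq : ℕ → List ℕ → ℕ → ℕ
diffSeq N π k = modN (N + entry N π (suc k) ∸ entry N π k) N

IsShiftInvariant : ℕ → List ℕ → ℕ → Set
IsShiftInvariant N π q = ∀ k → 1 ≤ k → diffSeq N π (k + q) ≡ diffSeq N π k

PeriodicWith : ℕ → List ℕ → ℕ → Set
PeriodicWith N π p =
  0 < p × p < N × IsShiftInvariant N π p
  × (∀ q → 0 < q → q < p → ¬ IsShiftInvariant N π q)

-- X_N = (0 1 … N) acting on {0,…,N}
cycX : ℕ → ℕ → ℕ
cycX N i = if i <ᵇ N then suc i else 0

-- Y_π = (π(N) … π(1) 0) : π(N) ↦ π(N-1) ↦ … ↦ π(1) ↦ 0 ↦ π(N)
cycY : ℕ → List ℕ → ℕ → ℕ
cycY N π zero    = nth π (N ∸ 1)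
cycY N π (suc x) with pos π (suc x)
... | zero        = suc x     -- not an entry (does not occur for x < N)
... | suc zero    = 0
... | suc (suc j) = nth π j   -- π(j+2) ↦ π(j+1)

cycC : ℕ → List ℕ → ℕ → ℕ
cycC N π i = cycY N π (cycX N i)

-- walk the cycle of C from x, collecting elements until 0 is reached;
-- nothing if N is reached again first (0 and N in different cycles)
spWalk : ℕ → (ℕ → ℕ) → ℕ → ℕ → Maybe (List ℕ)
spWalk N C zero    x = nothing
spWalk N C (suc f) x with C x ≟ 0
... | yes _ = just []
... | no  _ with C x ≟ N
...   | yes _ = nothing
...   | no  _ = mapMaybe (C x ∷_) (spWalk N C f (C x))

fromMaybeList : Maybe (List ℕ) → List ℕ
fromMaybeList (just l) = l
fromMaybeList nothing  = []

-- SP(π): the numbers after N and before 0 in the cycle of C_π containing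
-- 0 and N (empty if they lie in different cycles), in cycle order
SP : ℕ → List ℕ → List ℕ
SP N π = fromMaybeList (spWalk N (cycC N π) (suc N) N)

MaxSP : ℕ → List ℕ → Set
MaxSP N π = length (SP N π) ≡ N ∸ 1

contract : ℕ → List ℕ → List ℕ
contract N π = filter (λ x → ¬? (x ≟ N)) π

Pointer : Set
Pointer = ℕ × ℕ

_≟P_ : (p q : Pointer) → Dec (p ≡ q)
_≟P_ = ≡-dec _≟_ _≟_

-- W(π) = L(π(1)) R(π(1)) ⋯ L(π(N)) R(π(N)), with (0,1) and (N,N+1) removed
pointerWord : ℕ → List ℕ → List Pointer
pointerWord N π =
  filter (λ p → ¬? ((p ≟P (0 , 1)) ⊎-dec (p ≟P (N , suc N))))
         (concatMap (λ x → (x ∸ 1 , x) ∷ (x , suc x) ∷ []) π)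

-- the pointers (k,k+1), 1 ≤ k ≤ N-1, that occur in W(π)
pointers : ℕ → List Pointer
pointers N = map (λ k → (suc k , suc (suc k))) (upTo (N ∸ 1))

Interleave : List Pointer → Pointer → Pointer → Set
Interleave W p q =
  let s = filter (λ r → (r ≟P p) ⊎-dec (r ≟P q)) W in
  (s ≡ p ∷ q ∷ p ∷ q ∷ []) ⊎ (s ≡ q ∷ p ∷ q ∷ p ∷ [])

interleave? : ∀ W p q → Dec (Interleave W p q)
interleave? W p q =
  LP.≡-dec _≟P_ (filter (λ r → (r ≟P p) ⊎-dec (r ≟P q)) W) (p ∷ q ∷ p ∷ q ∷ [])
  ⊎-dec
  LP.≡-dec _≟P_ (filter (λ r → (r ≟P p) ⊎-dec (r ≟P q)) W) (q ∷ p ∷ q ∷ p ∷ [])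

-- unordered pairs of distinct list elements (as ordered by position)
pairs : {A : Set} → List A → List (A × A)
pairs []       = []
pairs (x ∷ xs) = map (x ,_) xs ++ pairs xs

numVPC : ℕ → List ℕ → ℕ
numVPC N π =
  length (filter (λ { (p , q) → interleave? (pointerWord N π) p q })
                 (pairs (pointers N)))

-- A strategic pile of size 2n - 1 makes the cycle of C_σ through 2n visit all of 1, …, 2n before
-- it reaches 0, so C_σ(0) = 2n: the entry 2n is immediately followed by 1. The pointer word of σ is
-- then the cyclic pointer word of its contraction π ∈ S_N, N = 2n - 1, with the pointers labelled
-- 1, …, N. If D_π has period p, rotating π by p positions adds a constant c modulo N to every entry,
-- so adding c to all labels just rotates the pointer word, and the number d(a) of pointers that
-- interleave with the pointer a satisfies d(a + c) = d(a). Hence the sequence of degrees along π is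
-- invariant under rotation by p, which forces p times its sum to be N times the sum of its first p
-- terms. That sum is twice the number of valid pointer contexts (handshake lemma), and N is odd, so
-- N divides p times this number.

module Submission where

open import Defs
open import Level using (0ℓ)
open import Function using (_∘_)
open import Algebra.Properties.CommutativeSemigroup using (interchange)
open import Data.Bool using (true; false)
open import Data.Empty using (⊥; ⊥-elim)
open import Data.Unit using (⊤; tt)
open import Data.Maybe using (just; nothing; fromMaybe)
open import Data.Product using (_×_; _,_; proj₁; proj₂; uncurry; ∃₂; ∃-syntax)
open import Data.Sum using (_⊎_; inj₁; inj₂; swap)
import Data.Sum as Sum
open import Data.Nat
  using ( ℕ; zero; suc; _+_; _*_; _∸_; _≤_; _<_; _⊓_; _%_; _<ᵇ_; z≤n; s≤s; NonZero; >-nonZero⁻¹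
        ; _≟_; _<?_; _≤?_)
open import Data.Nat.Properties
  using ( +-assoc; +-comm; +-suc; *-suc; *-comm; *-zeroʳ; *-distribˡ-+; *-distribʳ-+; suc-injective; suc-pred
        ; ≤-refl; ≤-trans; <⇒≤; <⇒≢; <-irrefl; <-≤-trans; ≤-pred; ≤∧≢⇒<; ≰⇒>; ≮⇒≥; m≤n⇒m<n∨m≡n
        ; n<1+n; n≤1+n; m≤m+n; m≤n+m; +-monoˡ-≤; +-monoˡ-<; +-cancelˡ-<; ∸-monoˡ-≤
        ; m∸n+n≡m; m+[n∸m]≡n; m≤n⇒m⊓n≡m
        ; <⇒<ᵇ; <ᵇ⇒<; +-commutativeSemigroup)
open import Data.Nat.DivMod using (m%n<n; m<n⇒m%n≡m; m%n%n≡m%n; %-distribˡ-+; [m+n]%n≡m%n; [m+kn]%n≡m%n)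
open import Data.Nat.Divisibility using (divides)
open import Data.Nat.Coprimality using (Coprime; gcd≡1⇒coprime; coprime-+; coprime-divisor)
open import Data.Nat.ListAction using (sum)
open import Data.Nat.ListAction.Properties using (sum-++; sum-↭)
open import Data.Nat.Tactic.RingSolver using (solve-∀)
open import Data.List using (List; []; _∷_; map; _++_; length; filter; upTo; head; concatMap; take; drop)
open import Data.List.Properties
  using ( ∷-injective; ≡-dec; ++-assoc; ++-cancelˡ; map-∘; map-cong; map-cong-local; map-++; concatMap-++
        ; filter-++; filter-≐; filter-all; filter-accept; filter-reject
        ; length-++; length-++-comm; length-map; length-upTo; length-take; length-drop; upTo-∷ʳ; take++drop≡id)
open import Data.List.Membership.Propositional using (_∈_; _∉_)
open import Data.List.Membership.Propositional.Properties
  using (∈-∃++; ∈-++⁻; ∈-++⁺ˡ; ∈-++⁺ʳ; ∈-map⁺; ∈-map⁻; ∈-upTo⁺; ∈-upTo⁻)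
open import Data.List.Membership.DecPropositional _≟_ using (_∈?_)
open import Data.List.Relation.Unary.Any using (here; there)
open import Data.List.Relation.Unary.All using (All; []; _∷_; lookup; zipWith; tabulate)
import Data.List.Relation.Unary.All as All
import Data.List.Relation.Unary.All.Properties as AllP
open import Data.List.Relation.Unary.AllPairs using ([]; _∷_)
open import Data.List.Relation.Unary.Unique.Propositional using (Unique)
open import Data.List.Relation.Unary.Unique.Propositional.Properties as Unique using (Unique[x∷xs]⇒x∉xs)
open import Data.List.Relation.Binary.Permutation.Propositional
  using (_↭_; ↭-sym; ↭-trans; ↭-prep; ↭⇒↭ₛ; module PermutationReasoning)
open import Data.List.Relation.Binary.Permutation.Propositional.Properties
  using (∈-resp-↭; ↭-length; filter-↭; map⁺; shift; drop-∷; ++-comm)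
open import Relation.Nullary using (Dec; yes; no; ¬_; ¬?; contradiction)
open import Relation.Nullary.Decidable using (_⊎-dec_; _×-dec_)
open import Relation.Unary using (Pred; Decidable)
open import Relation.Binary.Definitions using (DecidableEquality)
open import Relation.Binary.PropositionalEquality
open import Data.List.Relation.Binary.Permutation.Setoid.Properties (setoid ℕ) using (Unique-resp-↭)


indicator : {P : Set} → Dec P → ℕ
indicator (yes _) = 1
indicator (no _)  = 0

count : {A : Set} {P : Pred A 0ℓ} → Decidable P → List A → ℕ
count P? = length ∘ filter P?

module _ {A : Set} {P : Pred A 0ℓ} (P? : Decidable P) where

  count-∷ : ∀ x xs → count P? (x ∷ xs) ≡ indicator (P? x) + count P? xs
  count-∷ x xs with P? x
  ... | yes _ = refl
  ... | no  _ = refl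

  count-++ : ∀ xs ys → count P? (xs ++ ys) ≡ count P? xs + count P? ys
  count-++ xs ys = trans (cong length (filter-++ P? xs ys)) (length-++ (filter P? xs))

  count-↭ : ∀ {xs ys} → xs ↭ ys → count P? xs ≡ count P? ys
  count-↭ xs↭ys = ↭-length (filter-↭ P? xs↭ys)

  sum-indicator : ∀ xs → sum (map (indicator ∘ P?) xs) ≡ count P? xs
  sum-indicator []       = refl
  sum-indicator (x ∷ xs) = trans (cong (indicator (P? x) +_) (sum-indicator xs)) (sym (count-∷ x xs))

count-map : {A B : Set} {P : Pred B 0ℓ} (P? : Decidable P) (f : A → B) →
            ∀ xs → count P? (map f xs) ≡ count (P? ∘ f) xs
count-map P? f []       = refl
count-map P? f (x ∷ xs) = begin
  count P? (f x ∷ map f xs)                  ≡⟨ count-∷ P? (f x) (map f xs) ⟩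
  indicator (P? (f x)) + count P? (map f xs) ≡⟨ cong (indicator (P? (f x)) +_) (count-map P? f xs) ⟩
  indicator (P? (f x)) + count (P? ∘ f) xs   ≡⟨ count-∷ (P? ∘ f) x xs ⟨
  count (P? ∘ f) (x ∷ xs)                    ∎
  where open ≡-Reasoning

count-cong : {A : Set} {P Q : Pred A 0ℓ} (P? : Decidable P) (Q? : Decidable Q) →
             ∀ xs → (∀ {x} → x ∈ xs → (P x → Q x) × (Q x → P x)) → count P? xs ≡ count Q? xs
count-cong P? Q? []       _ = refl
count-cong P? Q? (x ∷ xs) P⇔Q
  rewrite count-∷ P? x xs | count-∷ Q? x xs | count-cong P? Q? xs (P⇔Q ∘ there)
  with P? x | Q? x
... | yes _  | yes _  = refl
... | no  _  | no  _  = refl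
... | yes px | no ¬qx = contradiction (proj₁ (P⇔Q (here refl)) px) ¬qx
... | no ¬px | yes qx = contradiction (proj₂ (P⇔Q (here refl)) qx) ¬px

sum-map-+ : {A : Set} (f g : A → ℕ) → ∀ xs →
            sum (map (λ a → f a + g a) xs) ≡ sum (map f xs) + sum (map g xs)
sum-map-+ f g []       = refl
sum-map-+ f g (x ∷ xs) = trans (cong (f x + g x +_) (sum-map-+ f g xs))
                               (interchange +-commutativeSemigroup (f x) (g x) (sum (map f xs)) (sum (map g xs)))

module Handshake {A : Set} {V : A → A → Set} (V? : ∀ a b → Dec (V a b))
                 (V-sym : ∀ {a b} → V a b → V b a) (V-irrefl : ∀ {a} → ¬ V a a) where

  degree : List A → A → ℕ
  degree xs a = count (V? a) xs

  edges : List A → ℕ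
  edges xs = count (uncurry V?) (pairs xs)

  handshake : ∀ xs → 2 * edges xs ≡ sum (map (degree xs) xs)
  handshake []       = refl
  handshake (x ∷ xs) = begin
    2 * edges (x ∷ xs)                                     ≡⟨ cong (2 *_) edges-∷ ⟩
    2 * (degree xs x + edges xs)                           ≡⟨ double-+ (degree xs x) (edges xs) ⟩
    degree xs x + (degree xs x + 2 * edges xs)
      ≡⟨ cong₂ (λ d e → d + (e + 2 * edges xs)) degree-self degree-back ⟩
    degree (x ∷ xs) x + (sum (map back xs) + 2 * edges xs)
      ≡⟨ cong (λ e → degree (x ∷ xs) x + (sum (map back xs) + e)) (handshake xs) ⟩
    degree (x ∷ xs) x + (sum (map back xs) + sum (map (degree xs) xs))
      ≡⟨ cong (degree (x ∷ xs) x +_) (sum-map-+ back (degree xs) xs) ⟨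
    degree (x ∷ xs) x + sum (map (λ a → back a + degree xs a) xs)
      ≡⟨ cong (λ ds → degree (x ∷ xs) x + sum ds) (map-cong (λ a → count-∷ (V? a) x xs) xs) ⟨
    sum (map (degree (x ∷ xs)) (x ∷ xs))                   ∎
    where
    open ≡-Reasoning
    back : A → ℕ
    back a = indicator (V? a x)
    edges-∷ : edges (x ∷ xs) ≡ degree xs x + edges xs
    edges-∷ = trans (count-++ (uncurry V?) (map (x ,_) xs) (pairs xs))
                    (cong (_+ edges xs) (count-map (uncurry V?) (x ,_) xs))
    double-+ : ∀ d e → 2 * (d + e) ≡ d + (d + 2 * e)
    double-+ = solve-∀
    degree-self : degree xs x ≡ degree (x ∷ xs) x
    degree-self with V? x x
    ... | yes Vxx = contradiction Vxx V-irrefl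
    ... | no  _   = refl
    degree-back : degree xs x ≡ sum (map back xs)
    degree-back = trans (count-cong (V? x) (λ a → V? a x) xs (λ _ → V-sym , V-sym))
                        (sym (sum-indicator (λ a → V? a x) xs))

pairs-map : {A B : Set} (f : A → B) (xs : List A) →
            pairs (map f xs) ≡ map (λ (a , b) → (f a , f b)) (pairs xs)
pairs-map f []       = refl
pairs-map f (x ∷ xs) = begin
  map (f x ,_) (map f xs) ++ pairs (map f xs)
    ≡⟨ cong₂ _++_ (trans (sym (map-∘ xs)) (map-∘ xs)) (pairs-map f xs) ⟩
  map (λ (a , b) → (f a , f b)) (map (x ,_) xs) ++ map (λ (a , b) → (f a , f b)) (pairs xs)
    ≡⟨ map-++ (λ (a , b) → (f a , f b)) (map (x ,_) xs) (pairs xs) ⟨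
  map (λ (a , b) → (f a , f b)) (map (x ,_) xs ++ pairs xs) ∎
  where open ≡-Reasoning

pairs-distinct : {A : Set} {xs : List A} → Unique xs → ∀ {a b} → (a , b) ∈ pairs xs → a ≢ b
pairs-distinct {xs = x ∷ xs} (x∉ ∷ xs-unique) ab∈ with ∈-++⁻ (map (x ,_) xs) ab∈
... | inj₁ ab∈xs with y , y∈ , refl ← ∈-map⁻ (x ,_) ab∈xs = lookup x∉ y∈
... | inj₂ ab∈pairs = pairs-distinct xs-unique ab∈pairs


filter-map : {A B : Set} {P : Pred B 0ℓ} {Q : Pred A 0ℓ} (P? : Decidable P) (Q? : Decidable Q)
             (f : A → B) → ∀ xs → (∀ {x} → x ∈ xs → (P (f x) → Q x) × (Q x → P (f x))) →
             filter P? (map f xs) ≡ map f (filter Q? xs)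
filter-map P? Q? f []       _    = refl
filter-map P? Q? f (x ∷ xs) P⇔Q with P? (f x) | Q? x | filter-map P? Q? f xs (P⇔Q ∘ there)
... | yes _   | yes _   | ih = cong (f x ∷_) ih
... | no  _   | no  _   | ih = ih
... | yes pfx | no ¬qx  | _  = contradiction (proj₁ (P⇔Q (here refl)) pfx) ¬qx
... | no ¬pfx | yes qx  | _  = contradiction (proj₂ (P⇔Q (here refl)) qx) ¬pfx

map-injectiveOn : {A B : Set} {S : Pred A 0ℓ} (f : A → B) →
                  (∀ {x y} → S x → S y → f x ≡ f y → x ≡ y) →
                  ∀ {xs ys} → All S xs → All S ys → map f xs ≡ map f ys → xs ≡ ys
map-injectiveOn f inj []         []         refl = refl
map-injectiveOn f inj (sx ∷ sxs) (sy ∷ sys) eq   =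
  cong₂ _∷_ (inj sx sy (proj₁ (∷-injective eq))) (map-injectiveOn f inj sxs sys (proj₂ (∷-injective eq)))

unique-suffix : {A : Set} (us ws us′ ws′ : List A) {y : A} →
                Unique (us ++ y ∷ ws) → us ++ y ∷ ws ≡ us′ ++ y ∷ ws′ → ws ≡ ws′
unique-suffix []       ws []         ws′ _        eq = proj₂ (∷-injective eq)
unique-suffix []       ws (z ∷ us′)  ws′ u       eq with refl , ws≡ ← ∷-injective eq =
  contradiction (subst (_ ∈_) (sym ws≡) (∈-++⁺ʳ us′ (here refl))) (Unique[x∷xs]⇒x∉xs u)
unique-suffix (z ∷ us) ws []         ws′ u       eq with refl , _ ← ∷-injective eq =
  contradiction (∈-++⁺ʳ us (here refl)) (Unique[x∷xs]⇒x∉xs u)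
unique-suffix (z ∷ us) ws (z′ ∷ us′) ws′ (_ ∷ u) eq with refl , eq′ ← ∷-injective eq =
  unique-suffix us ws us′ ws′ u eq′

unique-length-≤ : {A : Set} {xs ys : List A} → Unique xs → All (_∈ ys) xs → length xs ≤ length ys
unique-length-≤ {xs = []}     _         _            = z≤n
unique-length-≤ {xs = x ∷ xs} (x∉ ∷ u) (x∈ys ∷ xs⊆) with us , vs , refl ← ∈-∃++ x∈ys =
  subst (suc (length xs) ≤_) (sym (trans (length-++ us) (+-suc (length us) (length vs))))
        (s≤s (subst (length xs ≤_) (length-++ us) (unique-length-≤ u (zipWith delete (x∉ , xs⊆)))))
  where
  delete : ∀ {z} → x ≢ z × z ∈ us ++ x ∷ vs → z ∈ us ++ vs
  delete (x≢z , z∈) with ∈-++⁻ us z∈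
  ... | inj₁ z∈us         = ∈-++⁺ˡ z∈us
  ... | inj₂ (here refl)  = contradiction refl x≢z
  ... | inj₂ (there z∈vs) = ∈-++⁺ʳ us z∈vs

prefix-of-shorter : ∀ {A : Set} (ys xs : List A) {ys′ xs′} → ys ++ ys′ ≡ xs ++ xs′ →
                    length ys ≤ length xs → ∃[ zs ] xs ≡ ys ++ zs
prefix-of-shorter []       xs       _  _        = xs , refl
prefix-of-shorter (y ∷ ys) (x ∷ xs) eq (s≤s ≤) with refl , eq′ ← ∷-injective eq
                                               with zs , refl ← prefix-of-shorter ys xs eq′ ≤ = zs , refl

-- Commuting words are powers of a common word, so their letters have the same average.
commuting-sum : ∀ (xs ys : List ℕ) → xs ++ ys ≡ ys ++ xs → length ys * sum xs ≡ length xs * sum ys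
commuting-sum xs ys = bounded (length xs + length ys) xs ys ≤-refl
  where
  Claim : ℕ → Set
  Claim n = ∀ xs ys → length xs + length ys ≤ n → xs ++ ys ≡ ys ++ xs →
            length ys * sum xs ≡ length xs * sum ys

  -- the longer word is ys ++ zs, where zs again commutes with ys
  peel : ∀ {n} → Claim n → ∀ xs y ys → length (y ∷ ys) ≤ length xs →
         length xs + length (y ∷ ys) ≤ suc n → xs ++ y ∷ ys ≡ (y ∷ ys) ++ xs →
         length (y ∷ ys) * sum xs ≡ length xs * sum (y ∷ ys)
  peel {n} ih xs y ys short bound comm
    with zs , refl ← prefix-of-shorter (y ∷ ys) xs (sym comm) short = begin
    length yys * sum (yys ++ zs)               ≡⟨ cong (length yys *_) (sum-++ yys zs) ⟩
    length yys * (sum yys + sum zs)            ≡⟨ *-distribˡ-+ (length yys) (sum yys) (sum zs) ⟩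
    length yys * sum yys + length yys * sum zs ≡⟨ cong (length yys * sum yys +_) (ih zs yys zs-bound zs-comm) ⟩
    length yys * sum yys + length zs * sum yys ≡⟨ *-distribʳ-+ (sum yys) (length yys) (length zs) ⟨
    (length yys + length zs) * sum yys         ≡⟨ cong (_* sum yys) (length-++ yys) ⟨
    length (yys ++ zs) * sum yys               ∎
    where
    open ≡-Reasoning
    yys : List ℕ
    yys = y ∷ ys
    zs-comm : zs ++ yys ≡ yys ++ zs
    zs-comm = ++-cancelˡ yys (zs ++ yys) (yys ++ zs) (trans (sym (++-assoc yys zs yys)) comm)
    zs-bound : length zs + length yys ≤ n
    zs-bound = ≤-pred (≤-trans (s≤s (+-monoˡ-≤ (length yys) (m≤n+m (length zs) (length ys))))
                               (subst (λ k → k + length yys ≤ suc n) (length-++ yys) bound))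

  bounded : ∀ n → Claim n
  bounded n       xs       []       _     _    = sym (*-zeroʳ (length xs))
  bounded n       []       (y ∷ ys) _     _    = *-zeroʳ (length (y ∷ ys))
  bounded zero    (x ∷ xs) (y ∷ ys) ()    _
  bounded (suc n) (x ∷ xs) (y ∷ ys) bound comm with length (y ∷ ys) ≤? length (x ∷ xs)
  ... | yes short = peel (bounded n) (x ∷ xs) y ys short bound comm
  ... | no  long  = sym (peel (bounded n) (y ∷ ys) x xs (<⇒≤ (≰⇒> long))
                          (subst (_≤ suc n) (+-comm (length (x ∷ xs)) (length (y ∷ ys))) bound) (sym comm))

nth-∈ : ∀ xs {i} → i < length xs → nth xs i ∈ xs
nth-∈ (x ∷ xs) {zero}  _         = here refl
nth-∈ (x ∷ xs) {suc i} (s≤s i<n) = there (nth-∈ xs i<n)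

nth-ext : ∀ xs ys → length xs ≡ length ys → (∀ {i} → i < length xs → nth xs i ≡ nth ys i) → xs ≡ ys
nth-ext []       []       _   _  = refl
nth-ext (x ∷ xs) (y ∷ ys) len eq =
  cong₂ _∷_ (eq (s≤s z≤n)) (nth-ext xs ys (suc-injective len) (eq ∘ s≤s))

nth-map : ∀ (f : ℕ → ℕ) xs {i} → i < length xs → nth (map f xs) i ≡ f (nth xs i)
nth-map f (x ∷ xs) {zero}  _         = refl
nth-map f (x ∷ xs) {suc i} (s≤s i<n) = nth-map f xs i<n

nth-++ˡ : ∀ xs ys {i} → i < length xs → nth (xs ++ ys) i ≡ nth xs i
nth-++ˡ (x ∷ xs) ys {zero}  _         = refl
nth-++ˡ (x ∷ xs) ys {suc i} (s≤s i<n) = nth-++ˡ xs ys i<n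

nth-++ʳ : ∀ xs ys j → nth (xs ++ ys) (length xs + j) ≡ nth ys j
nth-++ʳ []       ys j = refl
nth-++ʳ (x ∷ xs) ys j = nth-++ʳ xs ys j

nth-drop : ∀ p xs i → nth (drop p xs) i ≡ nth xs (p + i)
nth-drop zero    xs       i = refl
nth-drop (suc p) []       i = refl
nth-drop (suc p) (x ∷ xs) i = nth-drop p xs i

nth-take : ∀ p xs {i} → i < p → nth (take p xs) i ≡ nth xs i
nth-take (suc p) []       _                 = refl
nth-take (suc p) (x ∷ xs) {zero}  _         = refl
nth-take (suc p) (x ∷ xs) {suc i} (s≤s i<p) = nth-take p xs i<p

nth-rotate : ∀ {N} .{{_ : NonZero N}} xs p {i} → length xs ≡ N → p ≤ N → i < N →
             nth (drop p xs ++ take p xs) i ≡ nth xs ((i + p) % N)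
nth-rotate {N} xs p {i} len p≤N i<N with i <? N ∸ p | trans (length-drop p xs) (cong (_∸ p) len)
... | yes i<N∸p | length-drop′ = begin
  nth (drop p xs ++ take p xs) i  ≡⟨ nth-++ˡ (drop p xs) (take p xs) (subst (i <_) (sym length-drop′) i<N∸p) ⟩
  nth (drop p xs) i               ≡⟨ nth-drop p xs i ⟩
  nth xs (p + i)                  ≡⟨ cong (nth xs) (trans (+-comm p i) (sym (m<n⇒m%n≡m i+p<N))) ⟩
  nth xs ((i + p) % N)            ∎
  where
  open ≡-Reasoning
  i+p<N : i + p < N
  i+p<N = subst (i + p <_) (m∸n+n≡m p≤N) (+-monoˡ-< p i<N∸p)
... | no i≮N∸p | length-drop′ = begin
  nth (drop p xs ++ take p xs) i                         ≡⟨ cong (nth (drop p xs ++ take p xs)) i≡ ⟨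
  nth (drop p xs ++ take p xs) (length (drop p xs) + j)  ≡⟨ nth-++ʳ (drop p xs) (take p xs) j ⟩
  nth (take p xs) j                                      ≡⟨ nth-take p xs j<p ⟩
  nth xs j                                               ≡⟨ cong (nth xs) [i+p]%N≡j ⟨
  nth xs ((i + p) % N)                                   ∎
  where
  open ≡-Reasoning
  N∸p≤i : N ∸ p ≤ i
  N∸p≤i = ≮⇒≥ i≮N∸p
  j : ℕ
  j = i ∸ (N ∸ p)
  i≡ : length (drop p xs) + j ≡ i
  i≡ = trans (cong (_+ j) length-drop′) (m+[n∸m]≡n N∸p≤i)
  j<p : j < p
  j<p = +-cancelˡ-< (N ∸ p) j p (subst₂ _<_ (sym (m+[n∸m]≡n N∸p≤i)) (sym (m∸n+n≡m p≤N)) i<N)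
  [i+p]%N≡j : (i + p) % N ≡ j
  [i+p]%N≡j = begin
    (i + p) % N                  ≡⟨ cong (λ k → (k + p) % N) (m+[n∸m]≡n N∸p≤i) ⟨
    ((N ∸ p) + j + p) % N        ≡⟨ cong (λ k → (k + p) % N) (+-comm (N ∸ p) j) ⟩
    (j + (N ∸ p) + p) % N        ≡⟨ cong (_% N) (trans (+-assoc j (N ∸ p) p) (cong (j +_) (m∸n+n≡m p≤N))) ⟩
    (j + N) % N                  ≡⟨ [m+n]%n≡m%n j N ⟩
    j % N                        ≡⟨ m<n⇒m%n≡m (<-≤-trans j<p p≤N) ⟩
    j                            ∎


odd-coprime-2 : ∀ m → Coprime (suc (2 * m)) 2
odd-coprime-2 zero    = gcd≡1⇒coprime refl
odd-coprime-2 (suc m) = subst (λ k → Coprime k 2) (two-more m) (coprime-+ (odd-coprime-2 m))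
  where
  two-more : ∀ m → 2 + suc (2 * m) ≡ suc (2 * suc m)
  two-more = solve-∀

2[1+m]∸1≡1+2m : ∀ m → 2 * suc m ∸ 1 ≡ suc (2 * m)
2[1+m]∸1≡1+2m m = +-suc m (m + 0)

coprime-2-cancel : ∀ {N x s} → Coprime N 2 → 2 * x ≡ N * s → ∃[ k ] x ≡ k * N
coprime-2-cancel {N} {x} {s} N⊥2 eq
  with divides k x≡kN ← coprime-divisor N⊥2 (divides s (trans eq (*-comm N s))) = k , x≡kN


-- At A = Pointer, Interleaves is the Interleave of Defs, definitionally.
module Interleaving {A : Set} (_≟_ : DecidableEquality A) where

  occurrences : A → A → List A → List A
  occurrences p q = filter (λ r → (r ≟ p) ⊎-dec (r ≟ q))

  Interleaves : List A → A → A → Set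
  Interleaves W p q = (occurrences p q W ≡ p ∷ q ∷ p ∷ q ∷ [])
                    ⊎ (occurrences p q W ≡ q ∷ p ∷ q ∷ p ∷ [])

  interleaves? : ∀ W p q → Dec (Interleaves W p q)
  interleaves? W p q = ≡-dec _≟_ (occurrences p q W) (p ∷ q ∷ p ∷ q ∷ [])
                ⊎-dec ≡-dec _≟_ (occurrences p q W) (q ∷ p ∷ q ∷ p ∷ [])

  interleaves-sym : ∀ W {p q} → Interleaves W p q → Interleaves W q p
  interleaves-sym W {p} {q} =
    subst (λ occ → (occ ≡ q ∷ p ∷ q ∷ p ∷ []) ⊎ (occ ≡ p ∷ q ∷ p ∷ q ∷ [])) occurrences-sym ∘ swap
    where
    occurrences-sym : occurrences p q W ≡ occurrences q p W
    occurrences-sym = filter-≐ (λ r → (r ≟ p) ⊎-dec (r ≟ q)) (λ r → (r ≟ q) ⊎-dec (r ≟ p)) (swap , swap) W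

  private
    rotate-pqpq : ∀ {p q : A} s t → s ++ t ≡ p ∷ q ∷ p ∷ q ∷ [] →
                  (t ++ s ≡ p ∷ q ∷ p ∷ q ∷ []) ⊎ (t ++ s ≡ q ∷ p ∷ q ∷ p ∷ [])
    rotate-pqpq []                    _       refl = inj₁ refl
    rotate-pqpq (_ ∷ [])              _       refl = inj₂ refl
    rotate-pqpq (_ ∷ _ ∷ [])          _       refl = inj₁ refl
    rotate-pqpq (_ ∷ _ ∷ _ ∷ [])      _       refl = inj₂ refl
    rotate-pqpq (_ ∷ _ ∷ _ ∷ _ ∷ [])  []      refl = inj₁ refl

  interleaves-rotate : ∀ X Y {p q} → Interleaves (X ++ Y) p q → Interleaves (Y ++ X) p q
  interleaves-rotate X Y {p} {q} I
    rewrite filter-++ (λ r → (r ≟ p) ⊎-dec (r ≟ q)) X Y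
          | filter-++ (λ r → (r ≟ p) ⊎-dec (r ≟ q)) Y X
    with I
  ... | inj₁ eq = rotate-pqpq (occurrences p q X) (occurrences p q Y) eq
  ... | inj₂ eq = swap (rotate-pqpq (occurrences p q X) (occurrences p q Y) eq)

module InterleavingMap {A B : Set} (_≟A_ : DecidableEquality A) (_≟B_ : DecidableEquality B)
                       {S : Pred A 0ℓ} (f : A → B)
                       (f-injectiveOn : ∀ {x y} → S x → S y → f x ≡ f y → x ≡ y) where
  open Interleaving _≟A_ using () renaming (occurrences to occurrencesA; Interleaves to InterleavesA)
  open Interleaving _≟B_ using () renaming (occurrences to occurrencesB; Interleaves to InterleavesB)

  occurrences-map : ∀ W {p q} → All S W → S p → S q →
                    occurrencesB (f p) (f q) (map f W) ≡ map f (occurrencesA p q W)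
  occurrences-map W {p} {q} SW Sp Sq = filter-map _ _ f W same
    where
    same : ∀ {x} → x ∈ W →
           (f x ≡ f p ⊎ f x ≡ f q → x ≡ p ⊎ x ≡ q) × (x ≡ p ⊎ x ≡ q → f x ≡ f p ⊎ f x ≡ f q)
    same x∈W = (λ { (inj₁ eq) → inj₁ (f-injectiveOn (lookup SW x∈W) Sp eq)
                  ; (inj₂ eq) → inj₂ (f-injectiveOn (lookup SW x∈W) Sq eq) })
             , (λ { (inj₁ refl) → inj₁ refl ; (inj₂ refl) → inj₂ refl })

  interleaves-map⇔ : ∀ W {p q} → All S W → S p → S q →
                     (InterleavesB (map f W) (f p) (f q) → InterleavesA W p q)
                   × (InterleavesA W p q → InterleavesB (map f W) (f p) (f q))
  interleaves-map⇔ W {p} {q} SW Sp Sq rewrite occurrences-map W SW Sp Sq =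
      Sum.map (map-injectiveOn f f-injectiveOn SOcc (Sp ∷ Sq ∷ Sp ∷ Sq ∷ []))
              (map-injectiveOn f f-injectiveOn SOcc (Sq ∷ Sp ∷ Sq ∷ Sp ∷ []))
    , Sum.map (cong (map f)) (cong (map f))
    where
    SOcc : All S (occurrencesA p q W)
    SOcc = AllP.filter⁺ _ SW


-- Arithmetic modulo N on the representatives 1, …, N

InRange : ℕ → ℕ → Set
InRange N x = 1 ≤ x × x ≤ N

module _ {n : ℕ} .{{_ : NonZero n}} where

  [m%n+o]%n≡[m+o]%n : ∀ m o → (m % n + o) % n ≡ (m + o) % n
  [m%n+o]%n≡[m+o]%n m o = begin
    (m % n + o) % n           ≡⟨ %-distribˡ-+ (m % n) o n ⟩
    (m % n % n + o % n) % n   ≡⟨ cong (λ r → (r + o % n) % n) (m%n%n≡m%n m n) ⟩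
    (m % n + o % n) % n       ≡⟨ %-distribˡ-+ m o n ⟨
    (m + o) % n               ∎
    where open ≡-Reasoning

  [m+o%n]%n≡[m+o]%n : ∀ m o → (m + o % n) % n ≡ (m + o) % n
  [m+o%n]%n≡[m+o]%n m o = begin
    (m + o % n) % n  ≡⟨ cong (_% n) (+-comm m (o % n)) ⟩
    (o % n + m) % n  ≡⟨ [m%n+o]%n≡[m+o]%n o m ⟩
    (o + m) % n      ≡⟨ cong (_% n) (+-comm o m) ⟩
    (m + o) % n      ∎
    where open ≡-Reasoning

  %-cancelʳ-+ : ∀ m k o → (m + o) % n ≡ (k + o) % n → m % n ≡ k % n
  %-cancelʳ-+ m k o eq = trans (add-back m) (trans (cong (λ r → (r + o * (n ∸ 1)) % n) eq) (sym (add-back k)))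
    where
    -- o + o * (n - 1) is a multiple of n
    add-back : ∀ m → m % n ≡ ((m + o) % n + o * (n ∸ 1)) % n
    add-back m = begin
      m % n                             ≡⟨ [m+kn]%n≡m%n m o n ⟨
      (m + o * n) % n                   ≡⟨ cong (λ k → (m + o * k) % n) (suc-pred n) ⟨
      (m + o * suc (n ∸ 1)) % n         ≡⟨ cong (λ k → (m + k) % n) (*-suc o (n ∸ 1)) ⟩
      (m + (o + o * (n ∸ 1))) % n       ≡⟨ cong (_% n) (+-assoc m o (o * (n ∸ 1))) ⟨
      (m + o + o * (n ∸ 1)) % n         ≡⟨ [m%n+o]%n≡[m+o]%n (m + o) (o * (n ∸ 1)) ⟨
      ((m + o) % n + o * (n ∸ 1)) % n   ∎
      where open ≡-Reasoning

module Cyclic (N : ℕ) .{{_ : NonZero N}} where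

  infixl 6 _⊕_

  _⊕_ : ℕ → ℕ → ℕ
  x ⊕ d = suc ((x ∸ 1 + d) % N)

  ⊕-inRange : ∀ x d → InRange N (x ⊕ d)
  ⊕-inRange x d = s≤s z≤n , m%n<n (x ∸ 1 + d) N

  ⊕-assoc : ∀ x c d → x ⊕ c ⊕ d ≡ x ⊕ (c + d)
  ⊕-assoc x c d = cong suc (trans ([m%n+o]%n≡[m+o]%n (x ∸ 1 + c) d) (cong (_% N) (+-assoc (x ∸ 1) c d)))

  ⊕-comm : ∀ x c d → x ⊕ c ⊕ d ≡ x ⊕ d ⊕ c
  ⊕-comm x c d = trans (⊕-assoc x c d) (trans (cong (x ⊕_) (+-comm c d)) (sym (⊕-assoc x d c)))

  ⊕-cancelʳ : ∀ {x y} c → InRange N x → InRange N y → x ⊕ c ≡ y ⊕ c → x ≡ y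
  ⊕-cancelʳ {suc x} {suc y} c (_ , x≤N) (_ , y≤N) eq = cong suc (begin
    x      ≡⟨ m<n⇒m%n≡m x≤N ⟨
    x % N  ≡⟨ %-cancelʳ-+ x y c (suc-injective eq) ⟩
    y % N  ≡⟨ m<n⇒m%n≡m y≤N ⟩
    y      ∎)
    where open ≡-Reasoning

  ⊕-difference : ∀ {x y} → InRange N x → InRange N y → x ⊕ (N + y ∸ x) % N ≡ y
  ⊕-difference {suc x} {suc y} (_ , x≤N) (_ , y≤N) = cong suc (begin
    (x + (N + suc y ∸ suc x) % N) % N  ≡⟨ [m+o%n]%n≡[m+o]%n x (N + suc y ∸ suc x) ⟩
    (x + (N + suc y ∸ suc x)) % N      ≡⟨ cong (λ k → (x + (k ∸ suc x)) % N) (+-suc N y) ⟩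
    (x + (N + y ∸ x)) % N              ≡⟨ cong (_% N) (m+[n∸m]≡n (≤-trans (<⇒≤ x≤N) (m≤m+n N y))) ⟩
    (N + y) % N                        ≡⟨ cong (_% N) (+-comm N y) ⟩
    (y + N) % N                        ≡⟨ [m+n]%n≡m%n y N ⟩
    y % N                              ≡⟨ m<n⇒m%n≡m y≤N ⟩
    y                                  ∎)
    where open ≡-Reasoning

  cyclicPred : ℕ → ℕ
  cyclicPred x = x ⊕ (N ∸ 1)

  cyclicPred-1 : cyclicPred 1 ≡ N
  cyclicPred-1 = trans (cong suc (m<n⇒m%n≡m N∸1<N)) (suc-pred N)
    where
    N∸1<N : N ∸ 1 < N
    N∸1<N = subst (N ∸ 1 <_) (suc-pred N) (n<1+n (N ∸ 1))

  cyclicPred-≥2 : ∀ {x} → 2 ≤ x → x ≤ N → cyclicPred x ≡ x ∸ 1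
  cyclicPred-≥2 {suc (suc y)} (s≤s (s≤s _)) x≤N = cong suc (begin
    (suc y + (N ∸ 1)) % N  ≡⟨ cong (_% N) (+-suc y (N ∸ 1)) ⟨
    (y + suc (N ∸ 1)) % N  ≡⟨ cong (λ k → (y + k) % N) (suc-pred N) ⟩
    (y + N) % N            ≡⟨ [m+n]%n≡m%n y N ⟩
    y % N                  ≡⟨ m<n⇒m%n≡m (≤-trans (n≤1+n (suc y)) x≤N) ⟩
    y                      ∎)
    where open ≡-Reasoning

  cyclicPred-⊕ : ∀ x c → cyclicPred (x ⊕ c) ≡ cyclicPred x ⊕ c
  cyclicPred-⊕ x c = ⊕-comm x c (N ∸ 1)

  -- The pointer word of π ∈ S_N in which the pointer (k, k+1) is recorded by its label k,
  -- the label N standing for the renamed pointer (N, 1).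
  pointerLabels : List ℕ → List ℕ
  pointerLabels []      = []
  pointerLabels (x ∷ π) = cyclicPred x ∷ x ∷ pointerLabels π

  pointerLabels-++ : ∀ π ρ → pointerLabels (π ++ ρ) ≡ pointerLabels π ++ pointerLabels ρ
  pointerLabels-++ []      ρ = refl
  pointerLabels-++ (x ∷ π) ρ = cong (λ w → cyclicPred x ∷ x ∷ w) (pointerLabels-++ π ρ)

  pointerLabels-⊕ : ∀ c π → pointerLabels (map (_⊕ c) π) ≡ map (_⊕ c) (pointerLabels π)
  pointerLabels-⊕ c []      = refl
  pointerLabels-⊕ c (x ∷ π) = cong₂ (λ y w → y ∷ x ⊕ c ∷ w) (cyclicPred-⊕ x c) (pointerLabels-⊕ c π)

  pointerLabels-inRange : ∀ {π} → All (InRange N) π → All (InRange N) (pointerLabels π)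
  pointerLabels-inRange {[]}    []       = []
  pointerLabels-inRange {x ∷ π} (x∈ ∷ π∈) = ⊕-inRange x (N ∸ 1) ∷ x∈ ∷ pointerLabels-inRange π∈


module _ {K : ℕ} where

  ∈-range1⁻ : ∀ {x} → x ∈ range1 K → InRange K x
  ∈-range1⁻ x∈ with i , i∈ , refl ← ∈-map⁻ suc x∈ = s≤s z≤n , ∈-upTo⁻ i∈

  ∈-range1⁺ : ∀ {x} → InRange K x → x ∈ range1 K
  ∈-range1⁺ {suc x} (_ , x<K) = ∈-map⁺ suc (∈-upTo⁺ x<K)

  length-range1 : length (range1 K) ≡ K
  length-range1 = trans (length-map suc (upTo K)) (length-upTo K)

  range1-unique : Unique (range1 K)
  range1-unique = Unique.map⁺ suc-injective (Unique.upTo⁺ K)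

  module _ {σ : List ℕ} (σ↭ : σ ↭ range1 K) where

    ↭range1⇒unique : Unique σ
    ↭range1⇒unique = Unique-resp-↭ (↭⇒↭ₛ (↭-sym σ↭)) range1-unique

    ↭range1⇒inRange : ∀ {x} → x ∈ σ → InRange K x
    ↭range1⇒inRange x∈σ = ∈-range1⁻ (∈-resp-↭ σ↭ x∈σ)

    ↭range1⇒∈ : ∀ {x} → InRange K x → x ∈ σ
    ↭range1⇒∈ x∈K = ∈-resp-↭ (↭-sym σ↭) (∈-range1⁺ x∈K)

    ↭range1⇒length : length σ ≡ K
    ↭range1⇒length = trans (↭-length σ↭) length-range1

pigeonhole : ∀ {K R y} → Unique R → All (InRange K) R → length R ≡ K → InRange K y → y ∈ R
pigeonhole {K} {R} {y} R-unique R-inRange R-length y-inRange with y ∈? R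
... | yes y∈R = y∈R
... | no  y∉R = contradiction
  (unique-length-≤ (y∉R′ ∷ R-unique) (∈-range1⁺ y-inRange ∷ All.map ∈-range1⁺ R-inRange))
  (subst₂ (λ m n → ¬ suc m ≤ n) (sym R-length) (sym length-range1) (<-irrefl refl))
  where
  y∉R′ : All (y ≢_) R
  y∉R′ = tabulate (λ z∈R y≡z → y∉R (subst (_∈ R) (sym y≡z) z∈R))


-- Maximal strategic piles

pos≡0⇒∉ : ∀ σ {x} → pos σ x ≡ 0 → x ∉ σ
pos≡0⇒∉ (y ∷ σ) {x} eq x∈ with x ≟ y
pos≡0⇒∉ (y ∷ σ) () x∈ | yes _
... | no x≢y with pos σ x in pos≡
... | zero with x∈
...   | here x≡y  = x≢y x≡y
...   | there x∈σ = pos≡0⇒∉ σ pos≡ x∈σ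

pos≡1⇒head : ∀ σ {x} → pos σ x ≡ 1 → ∃[ vs ] σ ≡ x ∷ vs
pos≡1⇒head (y ∷ σ) {x} eq with x ≟ y
... | yes refl = σ , refl
... | no _ with pos σ x
pos≡1⇒head (y ∷ σ) () | no _ | zero
pos≡1⇒head (y ∷ σ) () | no _ | suc _

pos≡2+⇒after : ∀ σ {x} j → pos σ x ≡ suc (suc j) → ∃₂ λ us vs → σ ≡ us ++ nth σ j ∷ x ∷ vs
pos≡2+⇒after (y ∷ σ) {x} j eq with x ≟ y
pos≡2+⇒after (y ∷ σ) j () | yes _
... | no _ with pos σ x in pos≡
pos≡2+⇒after (y ∷ σ) j () | no _ | zero
pos≡2+⇒after (y ∷ σ) zero refl | no _ | suc zero with vs , refl ← pos≡1⇒head σ pos≡ = [] , vs , refl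
pos≡2+⇒after (y ∷ σ) (suc j) refl | no _ | suc (suc j) with us , vs , eq ← pos≡2+⇒after σ j pos≡ =
  y ∷ us , vs , cong (y ∷_) eq

last-split : ∀ (σ : List ℕ) → 1 ≤ length σ → ∃[ us ] σ ≡ us ++ nth σ (length σ ∸ 1) ∷ []
last-split (x ∷ [])     _ = [] , refl
last-split (x ∷ y ∷ σ) _ with us , eq ← last-split (y ∷ σ) (s≤s z≤n) = x ∷ us , cong (x ∷_) eq

cycX-< : ∀ {K a} → a < K → cycX K a ≡ suc a
cycX-< {K} {a} a<K with a <ᵇ K | <⇒<ᵇ a<K
... | true | _ = refl

cycX-self : ∀ K → cycX K K ≡ 0
cycX-self K with K <ᵇ K | <ᵇ⇒< K K
... | false | _   = refl
... | true  | K<K = contradiction (K<K _) (<-irrefl refl)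

cycX-cases : ∀ {K a} → a ≤ K → (a < K × cycX K a ≡ suc a) ⊎ (a ≡ K × cycX K a ≡ 0)
cycX-cases a≤K with m≤n⇒m<n∨m≡n a≤K
... | inj₁ a<K  = inj₁ (a<K , cycX-< a<K)
... | inj₂ refl = inj₂ (refl , cycX-self _)

cycX-≤ : ∀ {K a} → a ≤ K → cycX K a ≤ K
cycX-≤ a≤K with cycX-cases a≤K
... | inj₁ (a<K , eq) = subst (_≤ _) (sym eq) a<K
... | inj₂ (_   , eq) = subst (_≤ _) (sym eq) z≤n

cycX-injective : ∀ {K a b} → a ≤ K → b ≤ K → cycX K a ≡ cycX K b → a ≡ b
cycX-injective a≤K b≤K eq with cycX-cases a≤K | cycX-cases b≤K
... | inj₁ (_ , ea) | inj₁ (_ , eb) = suc-injective (trans (sym ea) (trans eq eb))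
... | inj₂ (a≡K , _) | inj₂ (b≡K , _) = trans a≡K (sym b≡K)
... | inj₁ (_ , ea) | inj₂ (_ , eb) with () ← trans (sym ea) (trans eq eb)
... | inj₂ (_ , ea) | inj₁ (_ , eb) with () ← trans (sym ea) (trans eq eb)

module _ {K : ℕ} {σ : List ℕ} (σ↭ : σ ↭ range1 K) (1≤K : 1 ≤ K) where

  private
    0∷σ-unique : Unique (0 ∷ σ)
    0∷σ-unique = tabulate (λ x∈σ → <⇒≢ (proj₁ (↭range1⇒inRange σ↭ x∈σ))) ∷ ↭range1⇒unique σ↭

  -- In the cyclic sequence 0, σ(1), …, σ(K) the map Y_σ sends each entry to its predecessor, so what
  -- follows Y_σ(a) starts with a, except that nothing follows Y_σ(0) = σ(K).
  cycY-split : ∀ {a} → a ≤ K →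
               ∃₂ λ us ws → 0 ∷ σ ≡ us ++ cycY K σ a ∷ ws × fromMaybe 0 (head ws) ≡ a
  cycY-split {zero} _ with us , eq ← last-split σ (subst (1 ≤_) (sym (↭range1⇒length σ↭)) 1≤K) =
    0 ∷ us , [] , cong (0 ∷_) (subst (λ k → σ ≡ us ++ nth σ (k ∸ 1) ∷ []) (↭range1⇒length σ↭) eq) , refl
  cycY-split {suc x} x<K with pos σ (suc x) in pos≡
  ... | zero        = ⊥-elim (pos≡0⇒∉ σ pos≡ (↭range1⇒∈ σ↭ (s≤s z≤n , x<K)))
  ... | suc zero    with vs , eq ← pos≡1⇒head σ pos≡ = [] , suc x ∷ vs , cong (0 ∷_) eq , refl
  ... | suc (suc j) with us , vs , eq ← pos≡2+⇒after σ j pos≡ = 0 ∷ us , suc x ∷ vs , cong (0 ∷_) eq , refl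

  cycY-≤ : ∀ {a} → a ≤ K → cycY K σ a ≤ K
  cycY-≤ a≤K with us , _ , eq , _ ← cycY-split a≤K = bound (subst (_ ∈_) (sym eq) (∈-++⁺ʳ us (here refl)))
    where
    bound : ∀ {y} → y ∈ 0 ∷ σ → y ≤ K
    bound (here refl)  = z≤n
    bound (there y∈σ) = proj₂ (↭range1⇒inRange σ↭ y∈σ)

  cycY-injective : ∀ {a b} → a ≤ K → b ≤ K → cycY K σ a ≡ cycY K σ b → a ≡ b
  cycY-injective a≤K b≤K Ya≡Yb
    with us , ws , eq , hd ← cycY-split a≤K | us′ , ws′ , eq′ , hd′ ← cycY-split b≤K =
    trans (sym hd) (trans (cong (fromMaybe 0 ∘ head) ws≡ws′) hd′)
    where
    ws≡ws′ : ws ≡ ws′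
    ws≡ws′ = unique-suffix us ws us′ ws′ (subst Unique eq 0∷σ-unique)
               (trans (sym eq) (trans eq′ (cong (λ y → us′ ++ y ∷ ws′) (sym Ya≡Yb))))

-- The walk from K along an injection C of {0, …, K} never repeats itself, since every visited element
-- other than K has its C-preimage among the earlier ones. So a walk that collects K - 1 elements
-- before reaching 0 has visited all of 1, …, K, and only 0 is left to be mapped to K.
module StrategicWalk (K : ℕ) (C : ℕ → ℕ)
                     (C-≤ : ∀ {a} → a ≤ K → C a ≤ K)
                     (C-injective : ∀ {a b} → a ≤ K → b ≤ K → C a ≡ C b → a ≡ b) where

  Reached : List ℕ → List ℕ → Set
  Reached ys xs = ∀ {y} → y ∈ ys → y ≢ K → ∃[ z ] z ∈ xs × C z ≡ y

  record Trail (x : ℕ) (visited : List ℕ) : Set where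
    field
      unique  : Unique (x ∷ visited)
      inRange : All (InRange K) (x ∷ visited)
      reached : Reached (x ∷ visited) visited

  record ClosedTrail (R : List ℕ) : Set where
    field
      unique  : Unique R
      inRange : All (InRange K) R
      reached : Reached R R
      exit    : ∃[ z ] z ∈ R × C z ≡ 0

  trail-step : ∀ {x visited} → Trail x visited → C x ≢ 0 → C x ≢ K → Trail (C x) (x ∷ visited)
  trail-step {x} {visited} t Cx≢0 Cx≢K = record
    { unique  = tabulate fresh ∷ unique
    ; inRange = (≤∧≢⇒< z≤n (Cx≢0 ∘ sym) , C-≤ x≤K) ∷ inRange
    ; reached = λ { (here refl) _ → x , here refl , refl
                  ; (there y∈) y≢K → let z , z∈ , Cz≡y = reached y∈ y≢K in z , there z∈ , Cz≡y }
    }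
    where
    open Trail t
    x≤K : x ≤ K
    x≤K = proj₂ (lookup inRange (here refl))
    fresh : ∀ {z} → z ∈ x ∷ visited → C x ≢ z
    fresh z∈ Cx≡z with w , w∈ , Cw≡z ← reached z∈ (Cx≢K ∘ trans Cx≡z) =
      Unique[x∷xs]⇒x∉xs unique (subst (_∈ visited) w≡x w∈)
      where
      w≡x : w ≡ x
      w≡x = C-injective (proj₂ (lookup inRange (there w∈))) x≤K (trans Cw≡z (sym Cx≡z))

  walk-closes : ∀ fuel x visited {l} → spWalk K C fuel x ≡ just l → Trail x visited →
                ∃[ R ] ClosedTrail R × length R ≡ length l + suc (length visited)
  walk-closes (suc fuel) x visited eq t with C x ≟ 0
  walk-closes (suc fuel) x visited refl t | yes Cx≡0 = x ∷ visited , closed , refl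
    where
    open Trail t
    closed : ClosedTrail (x ∷ visited)
    closed = record { unique = unique ; inRange = inRange ; exit = x , here refl , Cx≡0
                    ; reached = λ y∈ y≢K → let z , z∈ , Cz≡y = reached y∈ y≢K in z , there z∈ , Cz≡y }
  ... | no Cx≢0 with C x ≟ K
  walk-closes (suc fuel) x visited () t | no _ | yes _
  ... | no Cx≢K with spWalk K C fuel (C x) in eq′
  walk-closes (suc fuel) x visited () t | no _ | no _ | nothing
  walk-closes (suc fuel) x visited refl t | no Cx≢0 | no Cx≢K | just l′
    with R , closed , len ← walk-closes fuel (C x) (x ∷ visited) eq′ (trail-step t Cx≢0 Cx≢K) =
    R , closed , trans len (+-suc (length l′) (suc (length visited)))

  closed-trail-no-preimage-of-C0 : ∀ {R w} → ClosedTrail R → w ∈ R → C w ≡ C 0 → ⊥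
  closed-trail-no-preimage-of-C0 {w = w} closed w∈ Cw≡C0 =
    <⇒≢ w-pos (sym (C-injective (proj₂ (lookup inRange w∈)) z≤n Cw≡C0))
    where
    open ClosedTrail closed
    w-pos : 1 ≤ w
    w-pos = proj₁ (lookup inRange w∈)

  closed-trail-∋C0 : ∀ {R} → ClosedTrail R → length R ≡ K → C 0 ≢ 0 → C 0 ∈ R
  closed-trail-∋C0 closed len C0≢0 = pigeonhole unique inRange len (≤∧≢⇒< z≤n (C0≢0 ∘ sym) , C-≤ z≤n)
    where open ClosedTrail closed

  closed-trail-C0 : ∀ {R} → ClosedTrail R → length R ≡ K → C 0 ≡ K
  closed-trail-C0 closed@record { exit = z , z∈ , Cz≡0 } len with C 0 ≟ K | C 0 ≟ 0
  ... | yes C0≡K | _        = C0≡K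
  ... | no _     | yes C0≡0 = ⊥-elim (closed-trail-no-preimage-of-C0 closed z∈ (trans Cz≡0 (sym C0≡0)))
  ... | no C0≢K  | no C0≢0
    with w , w∈ , Cw≡C0 ← ClosedTrail.reached closed (closed-trail-∋C0 closed len C0≢0) C0≢K =
    ⊥-elim (closed-trail-no-preimage-of-C0 closed w∈ Cw≡C0)

  initial-trail : 1 ≤ K → Trail K []
  initial-trail 1≤K = record
    { unique  = [] ∷ []
    ; inRange = (1≤K , ≤-refl) ∷ []
    ; reached = λ { (here refl) K≢K → contradiction refl K≢K }
    }

  maximal-walk⇒C0≡K : 2 ≤ K → length (fromMaybeList (spWalk K C (suc K) K)) ≡ K ∸ 1 → C 0 ≡ K
  maximal-walk⇒C0≡K 2≤K maximal with spWalk K C (suc K) K in eq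
  ... | nothing = contradiction maximal (<⇒≢ (∸-monoˡ-≤ 1 2≤K))
  ... | just l with R , closed , len ← walk-closes (suc K) K [] eq (initial-trail (≤-trans (s≤s z≤n) 2≤K)) =
    closed-trail-C0 closed (trans len (trans (cong (_+ 1) maximal) (m∸n+n≡m (≤-trans (s≤s z≤n) 2≤K))))

module _ {K : ℕ} {σ : List ℕ} (2≤K : 2 ≤ K) (σ↭ : σ ↭ range1 K) where

  private
    1≤K : 1 ≤ K
    1≤K = ≤-trans (s≤s z≤n) 2≤K

  maxSP⇒Y1≡K : MaxSP K σ → cycY K σ 1 ≡ K
  maxSP⇒Y1≡K maximal = trans (cong (cycY K σ) (sym (cycX-< 1≤K)))
    (StrategicWalk.maximal-walk⇒C0≡K K (cycC K σ) C-≤ C-injective 2≤K maximal)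
    where
    C-≤ : ∀ {a} → a ≤ K → cycC K σ a ≤ K
    C-≤ a≤K = cycY-≤ σ↭ 1≤K (cycX-≤ a≤K)
    C-injective : ∀ {a b} → a ≤ K → b ≤ K → cycC K σ a ≡ cycC K σ b → a ≡ b
    C-injective a≤K b≤K eq = cycX-injective a≤K b≤K (cycY-injective σ↭ 1≤K (cycX-≤ a≤K) (cycX-≤ b≤K) eq)

  maxSP⇒K-then-1 : MaxSP K σ → ∃₂ λ us vs → σ ≡ us ++ K ∷ 1 ∷ vs
  maxSP⇒K-then-1 maximal with cycY-split σ↭ 1≤K 1≤K
  ... | _      , []     , _  , ()
  ... | []     , 1 ∷ vs , eq , refl =
    contradiction (trans (proj₁ (∷-injective eq)) (maxSP⇒Y1≡K maximal)) (<⇒≢ 1≤K)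
  ... | _ ∷ us , 1 ∷ vs , eq , refl =
    us , vs , subst (λ y → σ ≡ us ++ y ∷ 1 ∷ vs) (maxSP⇒Y1≡K maximal) (proj₂ (∷-injective eq))


-- The contraction

range1-suc : ∀ N → range1 (suc N) ≡ range1 N ++ suc N ∷ []
range1-suc N = trans (cong (map suc) (sym (upTo-∷ʳ N))) (map-++ suc (upTo N) (N ∷ []))

module _ {N : ℕ} .{{_ : NonZero N}} {us vs : List ℕ} (σ↭ : us ++ suc N ∷ 1 ∷ vs ↭ range1 (suc N)) where

  private
    K-1-to-front : us ++ suc N ∷ 1 ∷ vs ↭ suc N ∷ 1 ∷ us ++ vs
    K-1-to-front = ↭-trans (shift (suc N) us (1 ∷ vs)) (↭-prep (suc N) (shift 1 us vs))

  K-then-1-inner : All (λ x → 2 ≤ x × x ≤ N) (us ++ vs)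
  K-then-1-inner = tabulate inner
    where
    inner : ∀ {x} → x ∈ us ++ vs → 2 ≤ x × x ≤ N
    inner x∈ with Unique-resp-↭ (↭⇒↭ₛ K-1-to-front) (↭range1⇒unique σ↭)
                | ↭range1⇒inRange σ↭ (∈-resp-↭ (↭-sym K-1-to-front) (there (there x∈)))
    ... | (_ ∷ K∉) ∷ 1∉ ∷ _ | 1≤x , x≤K =
      ≤∧≢⇒< 1≤x (lookup 1∉ x∈) , ≤-pred (≤∧≢⇒< x≤K (≢-sym (lookup K∉ x∈)))

  K-then-1-contraction↭ : us ++ 1 ∷ vs ↭ range1 N
  K-then-1-contraction↭ = drop-∷ (begin
    suc N ∷ us ++ 1 ∷ vs      ↭⟨ shift (suc N) us (1 ∷ vs) ⟨
    us ++ suc N ∷ 1 ∷ vs      ↭⟨ σ↭ ⟩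
    range1 (suc N)            ≡⟨ range1-suc N ⟩
    range1 N ++ suc N ∷ []    ↭⟨ ++-comm (range1 N) (suc N ∷ []) ⟩
    suc N ∷ range1 N          ∎)
    where open PermutationReasoning

  K-then-1-contract : contract (suc N) (us ++ suc N ∷ 1 ∷ vs) ≡ us ++ 1 ∷ vs
  K-then-1-contract = begin
    filter ≢K? (us ++ suc N ∷ 1 ∷ vs)                ≡⟨ filter-++ ≢K? us (suc N ∷ 1 ∷ vs) ⟩
    filter ≢K? us ++ filter ≢K? (suc N ∷ 1 ∷ vs)      ≡⟨ cong₂ _++_ (filter-all ≢K? us≢K) middle ⟩
    us ++ 1 ∷ vs                                      ∎
    where
    open ≡-Reasoning
    ≢K? : ∀ x → Dec (x ≢ suc N)
    ≢K? x = ¬? (x ≟ suc N)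
    below-K : ∀ {x} → 2 ≤ x × x ≤ N → x ≢ suc N
    below-K (_ , x≤N) refl = <-irrefl refl x≤N
    us≢K : All (_≢ suc N) us
    us≢K = All.map below-K (proj₁ (AllP.++⁻ us K-then-1-inner))
    vs≢K : All (_≢ suc N) vs
    vs≢K = All.map below-K (proj₂ (AllP.++⁻ us K-then-1-inner))
    middle : filter ≢K? (suc N ∷ 1 ∷ vs) ≡ 1 ∷ vs
    middle = trans (filter-reject ≢K? (λ K≢K → K≢K refl))
                   (trans (filter-accept ≢K? (<⇒≢ (s≤s (>-nonZero⁻¹ N)))) (cong (1 ∷_) (filter-all ≢K? vs≢K)))

pointer : ℕ → Pointer
pointer k = (k , suc k)

module _ (N : ℕ) .{{_ : NonZero N}} where
  open Cyclic N

  private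
    kept? : (p : Pointer) → Dec (¬ (p ≡ (0 , 1) ⊎ p ≡ (suc N , suc (suc N))))
    kept? p = ¬? ((p ≟P (0 , 1)) ⊎-dec (p ≟P (suc N , suc (suc N))))

    kept : ∀ {a} (b : ℕ) → 1 ≤ a → a ≤ N → ¬ ((a , b) ≡ (0 , 1) ⊎ (a , b) ≡ (suc N , suc (suc N)))
    kept b (s≤s _) _   (inj₁ ())
    kept b _       a≤N (inj₂ refl) = <-irrefl refl a≤N

    inner-pointerWord : ∀ {ws} → All (λ x → 2 ≤ x × x ≤ N) ws →
      filter kept? (concatMap (λ x → (x ∸ 1 , x) ∷ (x , suc x) ∷ []) ws) ≡ map pointer (pointerLabels ws)
    inner-pointerWord {[]}                 []                   = refl
    inner-pointerWord {suc (suc y) ∷ ws} ((2≤x@(s≤s (s≤s _)) , x≤N) ∷ inner) =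
      trans (filter-accept kept? (kept _ (s≤s z≤n) (≤-trans (n≤1+n (suc y)) x≤N)))
        (cong₂ _∷_ (cong pointer (sym (cyclicPred-≥2 2≤x x≤N)))
          (trans (filter-accept kept? (kept _ (s≤s z≤n) x≤N)) (cong (_ ∷_) (inner-pointerWord inner))))

  pointerWord-K-then-1 : ∀ {us vs} → All (λ x → 2 ≤ x × x ≤ N) (us ++ vs) →
    pointerWord (suc N) (us ++ suc N ∷ 1 ∷ vs) ≡ map pointer (pointerLabels (us ++ 1 ∷ vs))
  pointerWord-K-then-1 {us} {vs} inner = begin
    filter kept? (concatMap pointerPair (us ++ suc N ∷ 1 ∷ vs))
      ≡⟨ cong (filter kept?) (concatMap-++ pointerPair us (suc N ∷ 1 ∷ vs)) ⟩
    filter kept? (concatMap pointerPair us ++ concatMap pointerPair (suc N ∷ 1 ∷ vs))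
      ≡⟨ filter-++ kept? (concatMap pointerPair us) _ ⟩
    filter kept? (concatMap pointerPair us) ++ filter kept? (concatMap pointerPair (suc N ∷ 1 ∷ vs))
      ≡⟨ cong₂ _++_ (inner-pointerWord (proj₁ (AllP.++⁻ us inner))) middle ⟩
    map pointer (pointerLabels us) ++ map pointer (pointerLabels (1 ∷ vs))
      ≡⟨ map-++ pointer (pointerLabels us) _ ⟨
    map pointer (pointerLabels us ++ pointerLabels (1 ∷ vs))
      ≡⟨ cong (map pointer) (pointerLabels-++ us (1 ∷ vs)) ⟨
    map pointer (pointerLabels (us ++ 1 ∷ vs)) ∎
    where
    open ≡-Reasoning
    pointerPair : ℕ → List Pointer
    pointerPair x = (x ∸ 1 , x) ∷ (x , suc x) ∷ []
    1≤N : 1 ≤ N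
    1≤N = >-nonZero⁻¹ N
    rest : List Pointer
    rest = concatMap pointerPair vs
    -- the left pointer (N, N+1) of the entry N+1 takes the place of the renamed left pointer (N, 1) of 1
    middle : filter kept? (concatMap pointerPair (suc N ∷ 1 ∷ vs)) ≡ map pointer (pointerLabels (1 ∷ vs))
    middle =
      trans (filter-accept kept? {xs = (suc N , suc (suc N)) ∷ (0 , 1) ∷ (1 , 2) ∷ rest}
                           (kept (suc N) 1≤N ≤-refl))
        (cong₂ _∷_ (cong pointer (sym cyclicPred-1))
          (trans (filter-reject kept? {xs = (0 , 1) ∷ (1 , 2) ∷ rest} (λ kept′ → kept′ (inj₂ refl)))
            (trans (filter-reject kept? {xs = (1 , 2) ∷ rest} (λ kept′ → kept′ (inj₁ refl)))
              (trans (filter-accept kept? {xs = rest} (kept 2 ≤-refl 1≤N))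
                (cong (_ ∷_) (inner-pointerWord (proj₂ (AllP.++⁻ us inner))))))))


-- Periodic difference sequences

modN≡% : ∀ x N .{{_ : NonZero N}} → modN x N ≡ x % N
modN≡% x (suc n) = refl

module _ {N : ℕ} .{{_ : NonZero N}} {π : List ℕ} (π↭ : π ↭ range1 N) where
  open Cyclic N

  private
    i<length : ∀ {i} → i < N → i < length π
    i<length = subst (_ <_) (sym (↭range1⇒length π↭))

    entry≡nth : ∀ {i} → i < N → entry N π (suc i) ≡ nth π i
    entry≡nth {i} i<N = cong (nth π) (trans (modN≡% i N) (m<n⇒m%n≡m i<N))

  entry-inRange : ∀ k → InRange N (entry N π k)
  entry-inRange k = ↭range1⇒inRange π↭
    (subst (λ i → nth π i ∈ π) (sym (modN≡% (k ∸ 1) N)) (nth-∈ π (i<length (m%n<n (k ∸ 1) N))))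

  entry-suc : ∀ k → entry N π (suc k) ≡ entry N π k ⊕ diffSeq N π k
  entry-suc k = trans (sym (⊕-difference (entry-inRange k) (entry-inRange (suc k))))
                      (cong (entry N π k ⊕_) (sym (modN≡% _ N)))

  module _ {p : ℕ} (invariant : IsShiftInvariant N π p) where

    offset : ℕ
    offset = (N + entry N π (1 + p) ∸ entry N π 1) % N

    entry-+p : ∀ k → entry N π (suc k + p) ≡ entry N π (suc k) ⊕ offset
    entry-+p zero    = sym (⊕-difference (entry-inRange 1) (entry-inRange (1 + p)))
    entry-+p (suc k) = begin
      entry N π (suc (suc k) + p)                       ≡⟨ entry-suc (suc k + p) ⟩
      entry N π (suc k + p) ⊕ diffSeq N π (suc k + p)
        ≡⟨ cong₂ _⊕_ (entry-+p k) (invariant (suc k) (s≤s z≤n)) ⟩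
      entry N π (suc k) ⊕ offset ⊕ diffSeq N π (suc k)  ≡⟨ ⊕-comm (entry N π (suc k)) offset _ ⟩
      entry N π (suc k) ⊕ diffSeq N π (suc k) ⊕ offset  ≡⟨ cong (_⊕ offset) (entry-suc (suc k)) ⟨
      entry N π (suc (suc k)) ⊕ offset                  ∎
      where open ≡-Reasoning

    rotation≡map⊕offset : p ≤ N → drop p π ++ take p π ≡ map (_⊕ offset) π
    rotation≡map⊕offset p≤N = nth-ext _ _ lengths λ {i} i<len → let i<N = subst (i <_) N≡ i<len in begin
      nth (drop p π ++ take p π) i  ≡⟨ nth-rotate π p (↭range1⇒length π↭) p≤N i<N ⟩
      nth π ((i + p) % N)           ≡⟨ cong (nth π) (modN≡% (i + p) N) ⟨
      entry N π (suc i + p)         ≡⟨ entry-+p i ⟩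
      entry N π (suc i) ⊕ offset     ≡⟨ cong (_⊕ offset) (entry≡nth i<N) ⟩
      nth π i ⊕ offset               ≡⟨ nth-map (_⊕ offset) π (i<length i<N) ⟨
      nth (map (_⊕ offset) π) i      ∎
      where
      open ≡-Reasoning
      lengths : length (drop p π ++ take p π) ≡ length (map (_⊕ offset) π)
      lengths = trans (length-++-comm (drop p π) (take p π))
                      (trans (cong length (take++drop≡id p π)) (sym (length-map (_⊕ offset) π)))
      N≡ : length (drop p π ++ take p π) ≡ N
      N≡ = trans lengths (trans (length-map (_⊕ offset) π) (↭range1⇒length π↭))


-- Valid pointer contexts

module Crossings {N : ℕ} .{{_ : NonZero N}} {π : List ℕ} (π↭ : π ↭ range1 N) where
  open Cyclic N
  open Interleaving _≟_

  labels : List ℕ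
  labels = pointerLabels π

  -- Pairs counted by numVPC are distinct anyway; a ≢ b makes the relation irreflexive for the handshake.
  Crossing : ℕ → ℕ → Set
  Crossing a b = a ≢ b × Interleaves labels a b

  crossing? : ∀ a b → Dec (Crossing a b)
  crossing? a b = ¬? (a ≟ b) ×-dec interleaves? labels a b

  open Handshake crossing? (λ (a≢b , I) → ≢-sym a≢b , interleaves-sym labels I) (λ (a≢a , _) → a≢a refl)
    public

  numVPC≡edges : ∀ {σ} → pointerWord (suc N) σ ≡ map pointer labels → numVPC (suc N) σ ≡ edges (range1 N)
  numVPC≡edges {σ} word≡ = begin
    count interleaving? (pairs (pointers (suc N)))
      ≡⟨ cong (count interleaving? ∘ pairs) (map-∘ {g = pointer} {f = suc} (upTo N)) ⟩
    count interleaving? (pairs (map pointer (range1 N)))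
      ≡⟨ cong (count interleaving?) (pairs-map pointer (range1 N)) ⟩
    count interleaving? (map (λ (a , b) → (pointer a , pointer b)) (pairs (range1 N)))
      ≡⟨ count-map interleaving? (λ (a , b) → (pointer a , pointer b)) (pairs (range1 N)) ⟩
    count (λ (a , b) → interleaving? (pointer a , pointer b)) (pairs (range1 N))
      ≡⟨ count-cong _ (uncurry crossing?) (pairs (range1 N)) same ⟩
    edges (range1 N) ∎
    where
    open ≡-Reasoning
    open InterleavingMap _≟_ _≟P_ {S = λ _ → ⊤} pointer (λ _ _ → cong proj₁) using (interleaves-map⇔)
    interleaving? : (pq : Pointer × Pointer) → Dec (Interleave (pointerWord (suc N) σ) (proj₁ pq) (proj₂ pq))
    interleaving? (p , q) = interleave? (pointerWord (suc N) σ) p q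
    pointer-crossing⇔ : ∀ a b → (Interleave (map pointer labels) (pointer a) (pointer b) → Interleaves labels a b)
                              × (Interleaves labels a b → Interleave (map pointer labels) (pointer a) (pointer b))
    pointer-crossing⇔ a b = interleaves-map⇔ labels {a} {b} (All.universal _ labels) tt tt
    same : ∀ {a b} → (a , b) ∈ pairs (range1 N) →
           (Interleave (pointerWord (suc N) σ) (pointer a) (pointer b) → Crossing a b)
         × (Crossing a b → Interleave (pointerWord (suc N) σ) (pointer a) (pointer b))
    same {a} {b} ab∈ =
        (λ I → pairs-distinct (range1-unique {N}) ab∈ , proj₁ (pointer-crossing⇔ a b) (subst Word word≡ I))
      , (λ (_ , I) → subst Word (sym word≡) (proj₂ (pointer-crossing⇔ a b) I))
      where
      Word : List Pointer → Set
      Word w = Interleave w (pointer a) (pointer b)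

  module _ {p : ℕ} (invariant : IsShiftInvariant N π p) (p≤N : p ≤ N) where

    private
      c : ℕ
      c = offset π↭ invariant
      R : List ℕ
      R = range1 N
      π-inRange : All (InRange N) π
      π-inRange = tabulate (↭range1⇒inRange π↭)
      rotation : drop p π ++ take p π ≡ map (_⊕ c) π
      rotation = rotation≡map⊕offset π↭ invariant p≤N

    labels-split : labels ≡ pointerLabels (take p π) ++ pointerLabels (drop p π)
    labels-split = trans (cong pointerLabels (sym (take++drop≡id p π))) (pointerLabels-++ (take p π) (drop p π))

    labels-⊕ : map (_⊕ c) labels ≡ pointerLabels (drop p π) ++ pointerLabels (take p π)
    labels-⊕ = begin
      map (_⊕ c) (pointerLabels π)                          ≡⟨ pointerLabels-⊕ c π ⟨
      pointerLabels (map (_⊕ c) π)                          ≡⟨ cong pointerLabels rotation ⟨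
      pointerLabels (drop p π ++ take p π)                  ≡⟨ pointerLabels-++ (drop p π) (take p π) ⟩
      pointerLabels (drop p π) ++ pointerLabels (take p π)  ∎
      where open ≡-Reasoning

    -- adding c rotates the pointer word
    interleaves-⊕ : ∀ {a b} → InRange N a → InRange N b →
                    (Interleaves labels (a ⊕ c) (b ⊕ c) → Interleaves labels a b)
                  × (Interleaves labels a b → Interleaves labels (a ⊕ c) (b ⊕ c))
    interleaves-⊕ {a} {b} a∈ b∈ =
        (λ I → proj₁ map⇔ (subst Shifted (sym labels-⊕)
                 (interleaves-rotate (pointerLabels (take p π)) (pointerLabels (drop p π))
                   (subst Shifted labels-split I))))
      , (λ I → subst Shifted (sym labels-split)
                 (interleaves-rotate (pointerLabels (drop p π)) (pointerLabels (take p π))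
                   (subst Shifted labels-⊕ (proj₂ map⇔ I))))
      where
      open InterleavingMap _≟_ _≟_ {S = InRange N} (_⊕ c) (⊕-cancelʳ c) using (interleaves-map⇔)
      map⇔ : (Interleaves (map (_⊕ c) labels) (a ⊕ c) (b ⊕ c) → Interleaves labels a b)
           × (Interleaves labels a b → Interleaves (map (_⊕ c) labels) (a ⊕ c) (b ⊕ c))
      map⇔ = interleaves-map⇔ labels (pointerLabels-inRange π-inRange) a∈ b∈
      Shifted : List ℕ → Set
      Shifted w = Interleaves w (a ⊕ c) (b ⊕ c)

    ⊕-permutes-range : map (_⊕ c) R ↭ R
    ⊕-permutes-range = begin
      map (_⊕ c) R          ↭⟨ map⁺ (_⊕ c) (↭-sym π↭) ⟩
      map (_⊕ c) π          ≡⟨ rotation ⟨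
      drop p π ++ take p π  ↭⟨ ++-comm (drop p π) (take p π) ⟩
      take p π ++ drop p π  ≡⟨ take++drop≡id p π ⟩
      π                     ↭⟨ π↭ ⟩
      R                     ∎
      where open PermutationReasoning

    degree-⊕ : ∀ {a} → InRange N a → degree R (a ⊕ c) ≡ degree R a
    degree-⊕ {a} a∈ = begin
      count (crossing? (a ⊕ c)) R                ≡⟨ count-↭ (crossing? (a ⊕ c)) ⊕-permutes-range ⟨
      count (crossing? (a ⊕ c)) (map (_⊕ c) R)   ≡⟨ count-map (crossing? (a ⊕ c)) (_⊕ c) R ⟩
      count (λ b → crossing? (a ⊕ c) (b ⊕ c)) R  ≡⟨ count-cong _ (crossing? a) R same ⟩
      count (crossing? a) R                      ∎
      where
      open ≡-Reasoning
      same : ∀ {b} → b ∈ R →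
             (Crossing (a ⊕ c) (b ⊕ c) → Crossing a b) × (Crossing a b → Crossing (a ⊕ c) (b ⊕ c))
      same b∈ = let b∈N = ∈-range1⁻ b∈ in
          (λ (≢ , I) → ≢ ∘ cong (_⊕ c) , proj₁ (interleaves-⊕ a∈ b∈N) I)
        , (λ (≢ , I) → ≢ ∘ ⊕-cancelʳ c a∈ b∈N , proj₂ (interleaves-⊕ a∈ b∈N) I)

    periodic-edges : p * (2 * edges R) ≡ N * sum (map (degree R) (take p π))
    periodic-edges = begin
      p * (2 * edges R)                  ≡⟨ cong (p *_) (trans (handshake R) degree-sum) ⟩
      p * (sum T + sum X)                ≡⟨ *-distribˡ-+ p (sum T) (sum X) ⟩
      p * sum T + p * sum X              ≡⟨ cong (λ k → p * sum T + k * sum X) length-T ⟨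
      p * sum T + length T * sum X       ≡⟨ cong (p * sum T +_) (commuting-sum X T X++T≡T++X) ⟩
      p * sum T + length X * sum T       ≡⟨ cong (λ k → p * sum T + k * sum T) length-X ⟩
      p * sum T + (N ∸ p) * sum T        ≡⟨ *-distribʳ-+ (sum T) p (N ∸ p) ⟨
      (p + (N ∸ p)) * sum T              ≡⟨ cong (_* sum T) (m+[n∸m]≡n p≤N) ⟩
      N * sum T                          ∎
      where
      open ≡-Reasoning
      T X : List ℕ
      T = map (degree R) (take p π)
      X = map (degree R) (drop p π)
      degrees-π : map (degree R) π ≡ T ++ X
      degrees-π = trans (cong (map (degree R)) (sym (take++drop≡id p π)))
                        (map-++ (degree R) (take p π) (drop p π))
      degree-sum : sum (map (degree R) R) ≡ sum T + sum X
      degree-sum = trans (sum-↭ (map⁺ (degree R) (↭-sym π↭))) (trans (cong sum degrees-π) (sum-++ T X))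
      X++T≡T++X : X ++ T ≡ T ++ X
      X++T≡T++X = begin
        X ++ T                              ≡⟨ map-++ (degree R) (drop p π) (take p π) ⟨
        map (degree R) (drop p π ++ take p π) ≡⟨ cong (map (degree R)) rotation ⟩
        map (degree R) (map (_⊕ c) π)       ≡⟨ map-∘ π ⟨
        map (degree R ∘ (_⊕ c)) π           ≡⟨ map-cong-local (All.map degree-⊕ π-inRange) ⟩
        map (degree R) π                    ≡⟨ degrees-π ⟩
        T ++ X                              ∎
      length-T : length T ≡ p
      length-T = trans (length-map (degree R) (take p π))
                   (trans (length-take p π) (trans (cong (p ⊓_) (↭range1⇒length π↭)) (m≤n⇒m⊓n≡m p≤N)))
      length-X : length X ≡ N ∸ p
      length-X = trans (length-map (degree R) (drop p π))
                   (trans (length-drop p π) (cong (_∸ p) (↭range1⇒length π↭)))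

maxSP-periodic-crossings : ∀ N .{{_ : NonZero N}} {σ} → σ ↭ range1 (suc N) → MaxSP (suc N) σ →
                           ∀ {p} → p ≤ N → IsShiftInvariant N (contract (suc N) σ) p →
                           ∃[ s ] 2 * (numVPC (suc N) σ * p) ≡ N * s
maxSP-periodic-crossings N σ↭ maximal {p} p≤N invariant
  with us , vs , refl ← maxSP⇒K-then-1 (s≤s (>-nonZero⁻¹ N)) σ↭ maximal =
  sum (map (degree (range1 N)) (take p (us ++ 1 ∷ vs))) , (begin
    2 * (numVPC (suc N) (us ++ suc N ∷ 1 ∷ vs) * p)
      ≡⟨ cong (λ k → 2 * (k * p)) (numVPC≡edges {us ++ suc N ∷ 1 ∷ vs} word≡) ⟩
    2 * (edges (range1 N) * p)                       ≡⟨ reorder (edges (range1 N)) p ⟩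
    p * (2 * edges (range1 N))                       ≡⟨ periodic-edges contraction-invariant p≤N ⟩
    N * sum (map (degree (range1 N)) (take p (us ++ 1 ∷ vs))) ∎)
  where
  open ≡-Reasoning
  open Crossings (K-then-1-contraction↭ σ↭)
  word≡ : pointerWord (suc N) (us ++ suc N ∷ 1 ∷ vs) ≡ map pointer labels
  word≡ = pointerWord-K-then-1 N (K-then-1-inner σ↭)
  contraction-invariant : IsShiftInvariant N (us ++ 1 ∷ vs) p
  contraction-invariant = subst (λ π → IsShiftInvariant N π p) (K-then-1-contract σ↭) invariant
  reorder : ∀ e p → 2 * (e * p) ≡ p * (2 * e)
  reorder = solve-∀

theorem4p5 : (n : ℕ) → 2 ≤ n → (σ : List ℕ) → σ ↭ range1 (2 * n)
    → MaxSP (2 * n) σ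
    → (p : ℕ) → PeriodicWith (2 * n ∸ 1) (contract (2 * n) σ) p
    → ∃[ k ] numVPC (2 * n) σ * p ≡ k * (2 * n ∸ 1)
theorem4p5 (suc m) (s≤s _) σ σ↭ maximal p (_ , p<N , invariant , _) =
  coprime-2-cancel (subst (λ N → Coprime N 2) (sym (2[1+m]∸1≡1+2m m)) (odd-coprime-2 m))
    (proj₂ (maxSP-periodic-crossings (2 * suc m ∸ 1) {{subst NonZero (sym (2[1+m]∸1≡1+2m m)) _}}
                                     σ↭ maximal (<⇒≤ p<N) invariant))
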